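{- Let $G$ be a finite abelian group of order $r$ and exponent greater than $2$, and suppose $G$ is not a $2$-group. Let $g\in G$ and let $M,N$ be subgroups with $1<M\le N<G$. Then the number of inverse-closed subsets $S\subseteq G$ such that $S-gN$ is a union of cosets of $M$ is at most $2^{11r/24+|\mathcal{I}(G)|/2}$.
   Context: $\mathcal{I}(G)=\{x\in G\mid |x|\le 2\}$. $S-gN$ denotes set difference. -}

module Defs where

open import Data.Nat using (ℕ; zero; suc; _<_; _≤_; _+_; _*_; _^_)
open import Data.Fin using (Fin)
open import Data.Fin.Subset using (Subset; _∈_; _∉_; _⊆_)
open import Data.List using (List; length; filter)
open import Data.Fin.Properties using (_≟_)
open import Data.List using (allFin)
open import Data.Product using (Σ; ∃; _×_; _,_)
open import Relation.Binary.PropositionalEquality using (_≡_; _≢_)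
open import Relation.Nullary using (¬_)
open import Algebra.Structures using (IsAbelianGroup)

-- A finite abelian group of order r, presented on the carrier Fin r
-- (every finite abelian group of order r is isomorphic to one of these).
record FinAbGroup (r : ℕ) : Set where
  field
    _∙_   : Fin r → Fin r → Fin r
    ε     : Fin r
    _⁻¹   : Fin r → Fin r
    isAbelianGroup : IsAbelianGroup _≡_ _∙_ ε _⁻¹

module _ {r : ℕ} (G : FinAbGroup r) where
  open FinAbGroup G

  pow : Fin r → ℕ → Fin r
  pow x zero = ε
  pow x (suc n) = x ∙ pow x n

  IsExponent : ℕ → Set
  IsExponent e = (0 < e) × (∀ x → pow x e ≡ ε)
                 × (∀ d → 0 < d → (∀ x → pow x d ≡ ε) → e ≤ d)

  Is2Group : Set
  Is2Group = ∃ λ k → r ≡ 2 ^ k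

  IsSubgroup : Subset r → Set
  IsSubgroup H = (ε ∈ H) × (∀ x y → x ∈ H → y ∈ H → (x ∙ y) ∈ H)
                 × (∀ x → x ∈ H → (x ⁻¹) ∈ H)

  Nontrivial : Subset r → Set
  Nontrivial H = ∃ λ x → x ∈ H × x ≢ ε

  Proper : Subset r → Set
  Proper H = ∃ λ x → x ∉ H

  InCoset : Fin r → Subset r → Fin r → Set
  InCoset g N x = ∃ λ n → n ∈ N × x ≡ g ∙ n

  InDiff : Subset r → Fin r → Subset r → Fin r → Set
  InDiff S g N x = x ∈ S × ¬ InCoset g N x

  -- the set T (given by membership predicate) is a union of cosets of M:
  -- it is closed under translation by M (i.e. xM ⊆ T for each x ∈ T)
  UnionOfCosets : (Fin r → Set) → Subset r → Set
  UnionOfCosets T M = ∀ x m → T x → m ∈ M → T (x ∙ m)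

  InverseClosed : Subset r → Set
  InverseClosed S = ∀ x → x ∈ S → (x ⁻¹) ∈ S

  -- I(G) = { x ∈ G | |x| ≤ 2 } = { x | x² = 1 }, and its size
  sizeI : ℕ
  sizeI = length (filter (λ x → (x ∙ x) ≟ ε) (allFin r))

{-# OPTIONS --safe #-}
-- An admissible set S (inverse-closed, with S − gN a union of M-cosets) is a union of classes of
-- the equivalence generated by x ∼ x⁻¹ and, for x ∉ gN, x ∼ xm with m ∈ M.  So S is determined by
-- its trace on a set R of class representatives, and there are at most 2^|R| admissible sets.
-- Representatives: one element of each pair {x, x⁻¹} inside gN ∩ g⁻¹N, and the least element of
-- each set (xM ∪ x⁻¹M) − gN.  There are at most (|gN ∩ g⁻¹N| + |I ∩ gN|)/2 of the first kind, and
-- |gN| ≤ r/2.  An outside representative x owns the distinct elements x, xm, xm² outside gN ∩ g⁻¹N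
-- if some 1 ≠ m ∈ M has m² ≠ 1; otherwise, for an involution m ∈ M, it owns x and xm, and also
-- x⁻¹ and x⁻¹m unless x² ∈ {1, m}.  Those exceptional x are bounded through |I| and the number of
-- square roots of m, which is at most r/6: the subgroup {x | x² ∈ {1, m}} contains I and the coset
-- of square roots, and has index at least 3 because G is not a 2-group.  Hence 24|R| ≤ 11r + 12|I|.
module Submission where

open import Defs
open import Algebra.Bundles using (AbelianGroup)
import Algebra.Properties.AbelianGroup as AbelianGroupProperties
import Algebra.Properties.CommutativeSemigroup as CommutativeSemigroupProperties
open import Data.Bool using (Bool; true; false)
open import Data.Empty using (⊥-elim)
open import Data.Fin using (Fin)
import Data.Fin as F
import Data.Fin.Induction as F
import Data.Fin.Properties as F
open import Data.Fin.Properties using (_≟_; any?; all?; ¬∀⟶∃¬)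
open import Data.Fin.Subset using (Subset; _⊆_)
open import Data.Fin.Subset.Properties using (_∈?_; ⊆-antisym)
open import Data.List using (List; []; _∷_; length; map; filter; concat; allFin; _++_)
open import Data.List.Membership.Propositional.Properties
  using (∈-filter⁺; ∈-filter⁻; ∈-map⁺; ∈-map⁻; ∈-++⁺ˡ; ∈-++⁺ʳ; ∈-allFin)
open import Data.List.Properties
  using (length-++; length-map; length-filter; length-removeAt′; length-tabulate; filter-all; filter-none)
open import Data.List.Relation.Binary.Disjoint.Propositional using (Disjoint)
open import Data.List.Relation.Unary.All using (All; []; _∷_)
import Data.List.Relation.Unary.All as All
import Data.List.Relation.Unary.All.Properties as All
open import Data.List.Relation.Unary.AllPairs as AllPairs using (AllPairs; []; _∷_)
import Data.List.Relation.Unary.AllPairs.Properties as AllPairs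
open import Data.List.Relation.Unary.Any using (Any; here; there; index)
open import Data.List.Relation.Unary.Unique.Propositional using (Unique)
open import Data.List.Relation.Unary.Unique.Propositional.Properties as Unique using (allFin⁺)
open import Data.Nat using (ℕ; zero; suc; z≤n; s≤s; _<_; _≤_; _+_; _*_; _^_; _∸_)
open import Data.Nat.Induction using (<-wellFounded)
open import Data.Nat.ListAction using (sum)
open import Data.Nat.Properties
  using ( +-comm; +-suc; +-identityʳ; *-comm; *-assoc; *-identityʳ; ^-*-assoc
        ; ≤-trans; ≤-antisym; <⇒≤; ≮⇒≥; ≰⇒>; m≤m+n; m≤n+m; m<m+n; +-cancelˡ-≤
        ; +-mono-≤; +-monoˡ-≤; +-monoʳ-≤; *-monoˡ-≤; *-monoʳ-≤; ^-monoˡ-≤; ^-monoʳ-≤; ∸-monoʳ-<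
        ; module ≤-Reasoning)
open import Data.Product using (∃; _×_; _,_; proj₁; proj₂)
open import Data.Sum as Sum using (_⊎_; inj₁; inj₂; [_,_])
open import Data.Unit using (tt)
open import Function using (_∘_; id; Injective; _⇔_; Equivalence; mk⇔)
open import Function.Construct.Composition using (_⇔-∘_)
open import Function.Construct.Identity using (⇔-id)
open import Induction.WellFounded using (Acc; acc)
open import Level using (0ℓ)
open import Relation.Binary.PropositionalEquality
  using (_≡_; _≢_; refl; sym; trans; cong; cong₂; subst; module ≡-Reasoning)
open import Relation.Nullary using (¬_; Dec; yes; no; does)
open import Relation.Nullary.Decidable using (_⊎-dec_; _×-dec_; ¬?; map′)
open import Relation.Unary using (Pred; Decidable; _∪_; _∩_; ∁)
open import Relation.Unary.Properties using (_∪?_; _∩?_; ∁?)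

module _ where

  open import Data.List.Membership.Propositional using (_∈_; _─_)

  private
    variable
      A B : Set

  ∈-─ : ∀ {x z : B} {ys} (x∈ys : x ∈ ys) → z ∈ ys → z ≢ x → z ∈ ys ─ x∈ys
  ∈-─ (here refl) (here refl) z≢x = ⊥-elim (z≢x refl)
  ∈-─ (here _)    (there z∈)  _   = z∈
  ∈-─ (there _)   (here z≡y)  _   = here z≡y
  ∈-─ (there x∈)  (there z∈)  z≢x = there (∈-─ x∈ z∈ z≢x)

  injection-length-≤ : ∀ {P : Pred A 0ℓ} (f : A → B) → (∀ {x y} → P x → P y → f x ≡ f y → x ≡ y) →
                       ∀ {xs ys} → Unique xs → All P xs → All (λ x → f x ∈ ys) xs →
                       length xs ≤ length ys
  injection-length-≤ f f-injective {[]}     _ _ _ = z≤n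
  injection-length-≤ f f-injective {x ∷ xs} {ys} (x∉xs ∷ xs!) (Px ∷ Pxs) (fx∈ys ∷ fxs∈ys) = begin
    suc (length xs)            ≤⟨ s≤s (injection-length-≤ f f-injective xs! Pxs fxs∈ys─fx) ⟩
    suc (length (ys ─ fx∈ys))  ≡⟨ length-removeAt′ ys (index fx∈ys) ⟨
    length ys                  ∎
    where
    open ≤-Reasoning
    fxs∈ys─fx : All (λ z → f z ∈ ys ─ fx∈ys) xs
    fxs∈ys─fx = All.tabulate λ z∈xs → ∈-─ fx∈ys (All.lookup fxs∈ys z∈xs)
      (λ fz≡fx → All.lookup x∉xs z∈xs (sym (f-injective (All.lookup Pxs z∈xs) Px fz≡fx)))

  sublists : List B → List (List B)
  sublists []       = [] ∷ []
  sublists (x ∷ xs) = map (x ∷_) (sublists xs) ++ sublists xs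

  length-sublists : ∀ (xs : List B) → length (sublists xs) ≡ 2 ^ length xs
  length-sublists []       = refl
  length-sublists (x ∷ xs) = begin
    length (map (x ∷_) xss ++ xss)       ≡⟨ length-++ (map (x ∷_) xss) ⟩
    length (map (x ∷_) xss) + length xss  ≡⟨ cong₂ _+_ (length-map (x ∷_) xss) (sym (+-identityʳ _)) ⟩
    length xss + (length xss + 0)         ≡⟨ cong (λ n → n + (n + 0)) (length-sublists xs) ⟩
    2 ^ length (x ∷ xs)                   ∎
    where
    open ≡-Reasoning
    xss = sublists xs

  filter∈sublists : ∀ {P : Pred B 0ℓ} (P? : Decidable P) (xs : List B) → filter P? xs ∈ sublists xs
  filter∈sublists P? []       = here refl
  filter∈sublists P? (x ∷ xs) with does (P? x)
  ... | true  = ∈-++⁺ˡ (∈-map⁺ (x ∷_) (filter∈sublists P? xs))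
  ... | false = ∈-++⁺ʳ (map (x ∷_) (sublists xs)) (filter∈sublists P? xs)

module Counting (r : ℕ) where

  open import Data.List.Membership.Propositional using (_∈_)

  private
    variable
      P Q : Pred (Fin r) 0ℓ

  count : Decidable P → ℕ
  count P? = length (filter P? (allFin r))

  unique-length-≤-count : ∀ (P? : Decidable P) {xs} → Unique xs → All P xs → length xs ≤ count P?
  unique-length-≤-count P? xs! Pxs =
    injection-length-≤ id (λ _ _ → id) xs! Pxs (All.map (∈-filter⁺ P? (∈-allFin _)) Pxs)

  count-≤ : ∀ (P? : Decidable P) → count P? ≤ r
  count-≤ P? = subst (count P? ≤_) (length-tabulate id) (length-filter P? (allFin r))

  count-universal : ∀ (P? : Decidable P) → (∀ x → P x) → count P? ≡ r
  count-universal P? all = trans (cong length (filter-all P? (All.universal all (allFin r)))) (length-tabulate id)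

  ∈⇒1≤count : ∀ (P? : Decidable P) {x} → P x → 1 ≤ count P?
  ∈⇒1≤count P? Px = unique-length-≤-count P? ([] ∷ []) (Px ∷ [])

  count-none : ∀ (P? : Decidable P) → (∀ x → ¬ P x) → count P? ≡ 0
  count-none P? none = cong length (filter-none P? (All.universal none (allFin r)))

  count-mono : ∀ (P? : Decidable P) (Q? : Decidable Q) → (∀ {x} → P x → Q x) → count P? ≤ count Q?
  count-mono P? Q? P⊆Q =
    unique-length-≤-count Q? (Unique.filter⁺ P? (allFin⁺ r)) (All.map P⊆Q (All.all-filter P? (allFin r)))

  count-∁ : ∀ (P? : Decidable P) → count P? + count (∁? P?) ≡ r
  count-∁ P? = trans (go (allFin r)) (length-tabulate id)
    where
    go : ∀ xs → length (filter P? xs) + length (filter (∁? P?) xs) ≡ length xs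
    go []       = refl
    go (x ∷ xs) with P? x
    ... | yes _ = cong suc (go xs)
    ... | no  _ = trans (+-suc _ _) (cong suc (go xs))

  count-split : ∀ (P? : Decidable P) (Q? : Decidable Q) →
                count P? ≡ count (P? ∩? Q?) + count (P? ∩? ∁? Q?)
  count-split P? Q? = go (allFin r)
    where
    go : ∀ xs → length (filter P? xs) ≡ length (filter (P? ∩? Q?) xs) + length (filter (P? ∩? ∁? Q?) xs)
    go []       = refl
    go (x ∷ xs) with P? x | Q? x
    ... | yes _ | yes _ = cong suc (go xs)
    ... | yes _ | no  _ = trans (cong suc (go xs)) (sym (+-suc _ _))
    ... | no  _ | _     = go xs

  disjoint-images-count : ∀ {ι : Set} (F : ι → Fin r → Fin r) → (∀ i → Injective _≡_ _≡_ (F i)) →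
                          ∀ {D : ι → Pred (Fin r) 0ℓ} (D? : ∀ i → Decidable (D i)) (Q? : Decidable Q) →
                          ∀ {is} →
                          AllPairs (λ i j → ∀ {x y} → D i x → D j y → F i x ≢ F j y) is →
                          All (λ i → ∀ {x} → D i x → Q (F i x)) is →
                          sum (map (λ i → count (D? i)) is) ≤ count Q?
  disjoint-images-count {Q = Q} {ι} F F-injective {D} D? Q? {is} disjoint into-Q = begin
    sum (map (λ i → count (D? i)) is) ≡⟨ length-images is ⟨
    length (concat (map image is))    ≤⟨ unique-length-≤-count Q? images-unique images-in-Q ⟩
    count Q?                          ∎
    where
    open ≤-Reasoning
    image : ι → List (Fin r)
    image i = map (F i) (filter (D? i) (allFin r))

    ∈-image⁻ : ∀ {i z} → z ∈ image i → ∃ λ x → D i x × z ≡ F i x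
    ∈-image⁻ {i} z∈ with ∈-map⁻ (F i) z∈
    ... | x , x∈ , z≡Fx = x , proj₂ (∈-filter⁻ (D? i) {xs = allFin r} x∈) , z≡Fx

    length-images : ∀ is → length (concat (map image is)) ≡ sum (map (λ i → count (D? i)) is)
    length-images []       = refl
    length-images (i ∷ is) =
      trans (length-++ (image i)) (cong₂ _+_ (length-map (F i) (filter (D? i) (allFin r))) (length-images is))

    disjoint-images : ∀ {i j} → (∀ {x y} → D i x → D j y → F i x ≢ F j y) →
                      Disjoint (image i) (image j)
    disjoint-images disj (z∈i , z∈j) with ∈-image⁻ z∈i | ∈-image⁻ z∈j
    ... | x , Dx , refl | y , Dy , Fx≡Fy = disj Dx Dy Fx≡Fy

    images-unique : Unique (concat (map image is))
    images-unique = Unique.concat⁺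
      (All.map⁺ (All.universal (λ i → Unique.map⁺ (F-injective i) (Unique.filter⁺ (D? i) (allFin⁺ r))) is))
      (AllPairs.map⁺ (AllPairs.map disjoint-images disjoint))

    image-in-Q : ∀ {i} → (∀ {x} → D i x → Q (F i x)) → All Q (image i)
    image-in-Q {i} into = All.map⁺ (All.map into (All.all-filter (D? i) (allFin r)))

    images-in-Q : All Q (concat (map image is))
    images-in-Q = All.concat⁺ (All.map⁺ (All.map image-in-Q into-Q))

  count-≤-injection : ∀ (P? : Decidable P) (Q? : Decidable Q) (f : Fin r → Fin r) →
                      Injective _≡_ _≡_ f → (∀ {x} → P x → Q (f x)) → count P? ≤ count Q?
  count-≤-injection P? Q? f f-injective into-Q =
    subst (_≤ count Q?) (+-identityʳ (count P?))
      (disjoint-images-count (λ _ → f) (λ _ → f-injective) (λ _ → P?) Q? {tt ∷ []}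
        ([] ∷ []) (into-Q ∷ []))

module Group {r : ℕ} (G : FinAbGroup r) where

  open Counting r

  abelianGroup : AbelianGroup 0ℓ 0ℓ
  abelianGroup = record { isAbelianGroup = FinAbGroup.isAbelianGroup G }

  open AbelianGroup abelianGroup public
    using (_∙_; ε; _⁻¹; assoc; comm; identityˡ; identityʳ; inverseˡ; inverseʳ)
  open AbelianGroupProperties abelianGroup public
  open CommutativeSemigroupProperties (AbelianGroup.commutativeSemigroup abelianGroup) public
    using (interchange; xy∙z≈xz∙y)

  ∙-≡⇒⁻¹∙-≡ : ∀ {x y a b} → x ∙ a ≡ y ∙ b → x ⁻¹ ∙ y ≡ a ∙ b ⁻¹
  ∙-≡⇒⁻¹∙-≡ {x} {y} {a} {b} xa≡yb = sym (begin
    a ∙ b ⁻¹               ≡⟨ cong (_∙ b ⁻¹) (y≈x\\z x a (y ∙ b) xa≡yb) ⟩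
    x ⁻¹ ∙ (y ∙ b) ∙ b ⁻¹  ≡⟨ cong (_∙ b ⁻¹) (assoc (x ⁻¹) y b) ⟨
    x ⁻¹ ∙ y ∙ b ∙ b ⁻¹    ≡⟨ //-rightDividesʳ b (x ⁻¹ ∙ y) ⟩
    x ⁻¹ ∙ y               ∎)
    where open ≡-Reasoning

  square : Fin r → Fin r
  square x = x ∙ x

  ∙-≡-⁻¹∙⇒square : ∀ {x a b} → x ∙ a ≡ x ⁻¹ ∙ b → square x ≡ b ∙ a ⁻¹
  ∙-≡-⁻¹∙⇒square {x} {a} {b} xa≡x⁻¹b = x≈z//y (square x) a b (begin
    square x ∙ a       ≡⟨ assoc x x a ⟩
    x ∙ (x ∙ a)        ≡⟨ cong (x ∙_) xa≡x⁻¹b ⟩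
    x ∙ (x ⁻¹ ∙ b)     ≡⟨ \\-leftDividesˡ x b ⟩
    b                  ∎)
    where open ≡-Reasoning

  square-∙ : ∀ x y → square (x ∙ y) ≡ square x ∙ square y
  square-∙ x y = interchange x y x y

  square-∙-≡ : ∀ {x y a b} → square x ≡ a → square y ≡ b → square (x ∙ y) ≡ a ∙ b
  square-∙-≡ {x} {y} x²≡a y²≡b = trans (square-∙ x y) (cong₂ _∙_ x²≡a y²≡b)

  square-⁻¹ : ∀ x → square (x ⁻¹) ≡ square x ⁻¹
  square-⁻¹ x = ⁻¹-∙-comm x x

  _^2^_ : Fin r → ℕ → Fin r
  x ^2^ zero  = x
  x ^2^ suc k = square (x ^2^ k)

  IsSubgroupPred : Pred (Fin r) 0ℓ → Set
  IsSubgroupPred A = A ε × (∀ x y → A x → A y → A (x ∙ y)) × (∀ x → A x → A (x ⁻¹))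

  module SubgroupPred {A : Pred (Fin r) 0ℓ} (A-sub : IsSubgroupPred A) where

    ε-closed : A ε
    ε-closed = proj₁ A-sub

    ∙-closed : ∀ {x y} → A x → A y → A (x ∙ y)
    ∙-closed = proj₁ (proj₂ A-sub) _ _

    ⁻¹-closed : ∀ {x} → A x → A (x ⁻¹)
    ⁻¹-closed = proj₂ (proj₂ A-sub) _

    ⁻¹∙-closed : ∀ {x y} → A x → A y → A (x ⁻¹ ∙ y)
    ⁻¹∙-closed Ax Ay = ∙-closed (⁻¹-closed Ax) Ay

    ∉⇒⁻¹∉ : ∀ {x} → ¬ A x → ¬ A (x ⁻¹)
    ∉⇒⁻¹∉ {x} x∉A = x∉A ∘ subst A (⁻¹-involutive x) ∘ ⁻¹-closed

    ε∙⁻¹-∉ : ∀ {x} → ¬ A x → ¬ A (ε ∙ x ⁻¹)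
    ε∙⁻¹-∉ {x} x∉A = ∉⇒⁻¹∉ x∉A ∘ subst A (identityˡ (x ⁻¹))

    ∙-cancel-closed : ∀ {x y} → A (x ∙ y) → A y → A x
    ∙-cancel-closed {x} {y} Axy Ay = subst A (//-rightDividesʳ y x) (∙-closed Axy (⁻¹-closed Ay))

  cosets-count : ∀ {A B : Pred (Fin r) 0ℓ} (A? : Decidable A) (B? : Decidable B) → IsSubgroupPred A →
                 ∀ hs → AllPairs (λ h h′ → ¬ A (h ∙ h′ ⁻¹)) hs →
                 All (λ h → ∀ {x} → A x → B (x ∙ h)) hs → length hs * count A? ≤ count B?
  cosets-count {A} A? B? A-sub hs distinct into-B =
    subst (_≤ count B?) (sum-map-const hs)
      (disjoint-images-count (λ h x → x ∙ h) (λ h {x} {y} → ∙-cancelʳ h x y) (λ _ → A?) B?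
        (AllPairs.map disjoint distinct) into-B)
    where
    open SubgroupPred A-sub
    disjoint : ∀ {h h′} → ¬ A (h ∙ h′ ⁻¹) → ∀ {x y} → A x → A y → x ∙ h ≢ y ∙ h′
    disjoint h≁h′ Ax Ay xh≡yh′ = h≁h′ (subst A (∙-≡⇒⁻¹∙-≡ xh≡yh′) (⁻¹∙-closed Ax Ay))
    sum-map-const : ∀ hs → sum (map (λ _ → count A?) hs) ≡ length hs * count A?
    sum-map-const []       = refl
    sum-map-const (_ ∷ hs) = cong (count A? +_) (sum-map-const hs)

  module _ {A : Pred (Fin r) 0ℓ} (A? : Decidable A) (A-sub : IsSubgroupPred A)
           {h} (h∉A : ¬ A h) (h²∈A : A (square h)) where

    open SubgroupPred A-sub

    A∪Ah : Pred (Fin r) 0ℓ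
    A∪Ah = A ∪ (λ x → A (x ∙ h ⁻¹))

    A∪Ah? : Decidable A∪Ah
    A∪Ah? = A? ∪? (λ x → A? (x ∙ h ⁻¹))

    A∪Ah-subgroup : IsSubgroupPred A∪Ah
    A∪Ah-subgroup = inj₁ ε-closed , mul , inv
      where
      mul : ∀ x y → A∪Ah x → A∪Ah y → A∪Ah (x ∙ y)
      mul x y (inj₁ Ax) (inj₁ Ay) = inj₁ (∙-closed Ax Ay)
      mul x y (inj₁ Ax) (inj₂ Ayh) = inj₂ (subst A (sym (assoc x y (h ⁻¹))) (∙-closed Ax Ayh))
      mul x y (inj₂ Axh) (inj₁ Ay) = inj₂ (subst A (xy∙z≈xz∙y x (h ⁻¹) y) (∙-closed Axh Ay))
      mul x y (inj₂ Axh) (inj₂ Ayh) =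
        inj₁ (∙-cancel-closed (subst A (interchange x (h ⁻¹) y (h ⁻¹)) (∙-closed Axh Ayh))
                              (subst A (sym (square-⁻¹ h)) (⁻¹-closed h²∈A)))
      inv : ∀ x → A∪Ah x → A∪Ah (x ⁻¹)
      inv x (inj₁ Ax)  = inj₁ (⁻¹-closed Ax)
      inv x (inj₂ Axh) = inj₂ (subst A (sym (⁻¹-∙-comm x h)) (⁻¹-closed Axh²))
        where
        Axh² : A (x ∙ h)
        Axh² = subst A (trans (assoc x (h ⁻¹) (square h)) (cong (x ∙_) (\\-leftDividesʳ h h)))
                 (∙-closed Axh h²∈A)

    count-A∪Ah : count A∪Ah? ≡ 2 * count A?
    count-A∪Ah = ≤-antisym upper lower
      where
      upper : count A∪Ah? ≤ 2 * count A?
      upper = begin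
        count A∪Ah?                                   ≡⟨ count-split A∪Ah? A? ⟩
        count (A∪Ah? ∩? A?) + count (A∪Ah? ∩? ∁? A?)  ≤⟨ +-mono-≤ (count-mono _ A? proj₂) Ah≤A ⟩
        count A? + count A?                           ≡⟨ cong (count A? +_) (+-identityʳ _) ⟨
        2 * count A?                                  ∎
        where
        open ≤-Reasoning
        in-Ah : ∀ {x} → A∪Ah x × ¬ A x → A (x ∙ h ⁻¹)
        in-Ah (inj₁ Ax  , x∉A) = ⊥-elim (x∉A Ax)
        in-Ah (inj₂ Axh , _)   = Axh
        Ah≤A = count-≤-injection (A∪Ah? ∩? ∁? A?) A? (_∙ h ⁻¹) (λ {x} {y} → ∙-cancelʳ (h ⁻¹) x y)
                 in-Ah

      lower : 2 * count A? ≤ count A∪Ah?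
      lower = cosets-count A? A∪Ah? A-sub (ε ∷ h ∷ []) ((ε∙⁻¹-∉ h∉A ∷ []) ∷ [] ∷ [])
                (into-A ∷ into-Ah ∷ [])
        where
        into-A : ∀ {x} → A x → A∪Ah (x ∙ ε)
        into-A {x} Ax = inj₁ (subst A (sym (identityʳ x)) Ax)
        into-Ah : ∀ {x} → A x → A∪Ah (x ∙ h)
        into-Ah {x} Ax = inj₂ (subst A (sym (//-rightDividesʳ h x)) Ax)

  outside-square-inside : ∀ {A : Pred (Fin r) 0ℓ} (A? : Decidable A) {x} k → ¬ A x → A (x ^2^ k) →
                          ∃ λ h → ¬ A h × A (square h)
  outside-square-inside A? zero    x∉A Ax           = ⊥-elim (x∉A Ax)
  outside-square-inside A? {x} (suc k) x∉A Ax^2^1+k with A? (x ^2^ k)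
  ... | yes Ax^2^k = outside-square-inside A? k x∉A Ax^2^k
  ... | no  x^2^k∉A = x ^2^ k , x^2^k∉A , Ax^2^1+k

  -- While A ≠ G, some h ∉ A has h² ∈ A (all orders are powers of 2), and A ∪ Ah is twice as large.
  index-is-2-power : (∀ x → ∃ λ k → x ^2^ k ≡ ε) →
                     ∀ {A} (A? : Decidable A) → IsSubgroupPred A → ∃ λ k → r ≡ 2 ^ k * count A?
  index-is-2-power 2-power-orders A? A-sub = go A? A-sub (<-wellFounded (r ∸ count A?))
    where
    go : ∀ {A} (A? : Decidable A) → IsSubgroupPred A → Acc _<_ (r ∸ count A?) →
         ∃ λ k → r ≡ 2 ^ k * count A?
    go {A} A? A-sub (acc rec) with all? A?
    ... | yes all  = 0 , sym (trans (+-identityʳ _) (count-universal A? all))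
    ... | no  ¬all =
      let x , x∉A        = ¬∀⟶∃¬ r _ A? ¬all
          k , x^2^k≡ε    = 2-power-orders x
          h , h∉A , h²∈A = outside-square-inside A? k x∉A (subst A (sym x^2^k≡ε) (proj₁ A-sub))
      in extend h∉A h²∈A
      where
      c = count A?

      extend : ∀ {h} → ¬ A h → A (square h) → ∃ λ k → r ≡ 2 ^ k * c
      extend h∉A h²∈A =
        let j , r≡2^j*2c = go A∪Ah?′ (A∪Ah-subgroup A? A-sub h∉A h²∈A) (rec shrinks)
        in suc j , trans r≡2^j*2c (trans (cong (2 ^ j *_) doubled)
                                         (trans (sym (*-assoc (2 ^ j) 2 c)) (cong (_* c) (*-comm (2 ^ j) 2))))
        where
        A∪Ah?′ = A∪Ah? A? A-sub h∉A h²∈A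
        doubled : count A∪Ah?′ ≡ 2 * c
        doubled = count-A∪Ah A? A-sub h∉A h²∈A
        shrinks : r ∸ count A∪Ah?′ < r ∸ c
        shrinks = ∸-monoʳ-< (subst (c <_) (sym doubled) (m<m+n c 0<c+0)) (count-≤ A∪Ah?′)
          where 0<c+0 = ≤-trans (∈⇒1≤count A? (proj₁ A-sub)) (m≤m+n c 0)

  count-ε : count (_≟ ε) ≡ 1
  count-ε = ≤-antisym only-ε (∈⇒1≤count (_≟ ε) refl)
    where
    only-ε : count (_≟ ε) ≤ 1
    only-ε = injection-length-≤ id (λ _ _ → id) {ys = ε ∷ []} (Unique.filter⁺ (_≟ ε) (allFin⁺ r))
               (All.all-filter (_≟ ε) (allFin r)) (All.map (here) (All.all-filter (_≟ ε) (allFin r)))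

  2-power-orders⇒2-group : (∀ x → ∃ λ k → x ^2^ k ≡ ε) → Is2Group G
  2-power-orders⇒2-group 2-power-orders =
    let k , r≡2^k*1 = index-is-2-power 2-power-orders (_≟ ε) trivial-subgroup
    in k , trans r≡2^k*1 (trans (cong (2 ^ k *_) count-ε) (*-identityʳ (2 ^ k)))
    where
    trivial-subgroup : IsSubgroupPred (_≡ ε)
    trivial-subgroup = refl , (λ { _ _ refl refl → identityˡ ε }) , (λ { _ refl → ε⁻¹≈ε })

  index≥3 : ∀ {A : Pred (Fin r) 0ℓ} (A? : Decidable A) → IsSubgroupPred A →
            ∀ {h} → ¬ A h → ¬ A (square h) → 3 * count A? ≤ r
  index≥3 {A} A? A-sub {h} h∉A h²∉A =
    subst (3 * count A? ≤_) (count-universal (λ _ → yes tt) _)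
      (cosets-count A? (λ _ → yes tt) A-sub (ε ∷ h ∷ square h ∷ [])
        ((ε∙⁻¹-∉ h∉A ∷ ε∙⁻¹-∉ h²∉A ∷ []) ∷ (h∙h²⁻¹∉A ∷ []) ∷ [] ∷ [])
        (_ ∷ _ ∷ _ ∷ []))
    where
    open SubgroupPred A-sub
    h∙h²⁻¹∉A : ¬ A (h ∙ square h ⁻¹)
    h∙h²⁻¹∉A = ∉⇒⁻¹∉ h∉A ∘ subst A h∙h²⁻¹≡h⁻¹
      where
      h∙h²⁻¹≡h⁻¹ : h ∙ square h ⁻¹ ≡ h ⁻¹
      h∙h²⁻¹≡h⁻¹ = trans (cong (h ∙_) (sym (⁻¹-∙-comm h h))) (\\-leftDividesˡ h (h ⁻¹))

  -- I(G); count I? unfolds to sizeI G.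
  I : Pred (Fin r) 0ℓ
  I x = square x ≡ ε

  I? : Decidable I
  I? x = square x ≟ ε

  I-subgroup : IsSubgroupPred I
  I-subgroup = identityˡ ε
             , (λ x y x²≡ε y²≡ε → trans (square-∙-≡ x²≡ε y²≡ε) (identityˡ ε))
             , (λ x x²≡ε → trans (square-⁻¹ x) (trans (cong _⁻¹ x²≡ε) ε⁻¹≈ε))

  module SquareRoots {m : Fin r} (m≢ε : m ≢ ε) (m²≡ε : square m ≡ ε) where

    Root : Pred (Fin r) 0ℓ
    Root x = square x ≡ m

    Root? : Decidable Root
    Root? x = square x ≟ m

    J : Pred (Fin r) 0ℓ
    J = I ∪ Root

    J? : Decidable J
    J? = I? ∪? Root?

    I⇒¬Root : ∀ {x} → I x → ¬ Root x
    I⇒¬Root x²≡ε x²≡m = m≢ε (trans (sym x²≡m) x²≡ε)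

    m⁻¹≡m : m ⁻¹ ≡ m
    m⁻¹≡m = sym (inverseʳ-unique m m m²≡ε)

    J-subgroup : IsSubgroupPred J
    J-subgroup = inj₁ (identityˡ ε) , mul , inv
      where
      mul : ∀ x y → J x → J y → J (x ∙ y)
      mul x y (inj₁ x²≡ε) (inj₁ y²≡ε) = inj₁ (trans (square-∙-≡ x²≡ε y²≡ε) (identityˡ ε))
      mul x y (inj₁ x²≡ε) (inj₂ y²≡m) = inj₂ (trans (square-∙-≡ x²≡ε y²≡m) (identityˡ m))
      mul x y (inj₂ x²≡m) (inj₁ y²≡ε) = inj₂ (trans (square-∙-≡ x²≡m y²≡ε) (identityʳ m))
      mul x y (inj₂ x²≡m) (inj₂ y²≡m) = inj₁ (trans (square-∙-≡ x²≡m y²≡m) m²≡ε)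
      inv : ∀ x → J x → J (x ⁻¹)
      inv x (inj₁ x²≡ε) = inj₁ (trans (square-⁻¹ x) (trans (cong _⁻¹ x²≡ε) ε⁻¹≈ε))
      inv x (inj₂ x²≡m) = inj₂ (trans (square-⁻¹ x) (trans (cong _⁻¹ x²≡m) m⁻¹≡m))

    J⇒square²≡ε : ∀ {x} → J x → square (square x) ≡ ε
    J⇒square²≡ε (inj₁ x²≡ε) = trans (cong square x²≡ε) (identityˡ ε)
    J⇒square²≡ε (inj₂ x²≡m) = trans (cong square x²≡m) m²≡ε

    square-roots-bound : ¬ Is2Group G → 6 * count Root? ≤ r
    square-roots-bound not-2-group with any? Root?
    ... | no no-root =
      subst (λ q → 6 * q ≤ r) (sym (count-none Root? (λ x x²≡m → no-root (x , x²≡m)))) z≤n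
    ... | yes (x₀ , x₀²≡m) = begin
      6 * count Root?        ≡⟨ *-assoc 3 2 (count Root?) ⟩
      3 * (2 * count Root?)  ≤⟨ *-monoʳ-≤ 3 (*-monoʳ-≤ 2 roots≤I) ⟩
      3 * (2 * count I?)     ≤⟨ *-monoʳ-≤ 3 2I≤J ⟩
      3 * count J?           ≤⟨ 3J≤r ⟩
      r                      ∎
      where
      open ≤-Reasoning
      roots≤I : count Root? ≤ count I?
      roots≤I = count-≤-injection Root? I? (_∙ x₀ ⁻¹) (λ {x} {y} → ∙-cancelʳ (x₀ ⁻¹) x y)
        (λ x²≡m → trans (square-∙-≡ x²≡m (trans (square-⁻¹ x₀) (cong _⁻¹ x₀²≡m))) (inverseʳ m))
      2I≤J : 2 * count I? ≤ count J?
      2I≤J = cosets-count I? J? I-subgroup (ε ∷ x₀ ∷ [])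
        ((SubgroupPred.ε∙⁻¹-∉ I-subgroup (λ x₀²≡ε → I⇒¬Root x₀²≡ε x₀²≡m) ∷ []) ∷ [] ∷ [])
        ((λ {x} x²≡ε → inj₁ (trans (cong square (identityʳ x)) x²≡ε))
        ∷ (λ x²≡ε → inj₂ (trans (square-∙-≡ x²≡ε x₀²≡m) (identityˡ m))) ∷ [])
      3J≤r : 3 * count J? ≤ r
      3J≤r with all? (λ h → J? h ⊎-dec J? (square h))
      ... | yes all = ⊥-elim (not-2-group (2-power-orders⇒2-group (λ h →
              [ (λ Jh → 2 , J⇒square²≡ε Jh) , (λ Jh² → 3 , J⇒square²≡ε Jh²) ] (all h))))
      ... | no ¬all =
        let h , h∉J∪J² = ¬∀⟶∃¬ r _ (λ h → J? h ⊎-dec J? (square h)) ¬all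
        in index≥3 J? J-subgroup (h∉J∪J² ∘ inj₁) (h∉J∪J² ∘ inj₂)

module AdmissibleSets {r : ℕ} (Admissible : Subset r → Set) where

  open import Data.Fin.Subset using (_∈_)
  open Counting r

  infix 4 _∼_

  _∼_ : Fin r → Fin r → Set
  x ∼ y = ∀ S → Admissible S → x ∈ S ⇔ y ∈ S

  admissible-count : ∀ {R : Pred (Fin r) 0ℓ} (R? : Decidable R) → (∀ x → ∃ λ y → R y × x ∼ y) →
                     ∀ {Ss} → Unique Ss → All Admissible Ss → length Ss ≤ 2 ^ count R?
  admissible-count {R} R? represented {Ss} Ss! admissible = begin
    length Ss               ≤⟨ injection-length-≤ trace trace-injective Ss! admissible traces-sublists ⟩
    length (sublists reps)  ≡⟨ length-sublists reps ⟩
    2 ^ count R?            ∎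
    where
    open ≤-Reasoning
    reps : List (Fin r)
    reps = filter R? (allFin r)

    trace : Subset r → List (Fin r)
    trace S = filter (_∈? S) reps

    traces-sublists : All (λ S → Any (trace S ≡_) (sublists reps)) Ss
    traces-sublists = All.universal (λ S → filter∈sublists (_∈? S) reps) Ss

    trace-⊆ : ∀ {S S′} → Admissible S → Admissible S′ → trace S ≡ trace S′ → S ⊆ S′
    trace-⊆ {S} {S′} S-adm S′-adm same {x} x∈S =
      let y , Ry , x∼y = represented x
          y∈S          = Equivalence.to (x∼y S S-adm) x∈S
          y∈traceS     = ∈-filter⁺ (_∈? S) (∈-filter⁺ R? (∈-allFin y) Ry) y∈S
          y∈S′         = proj₂ (∈-filter⁻ (_∈? S′) {xs = reps} (subst (Any (y ≡_)) same y∈traceS))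
      in Equivalence.from (x∼y S′ S′-adm) y∈S′

    trace-injective : ∀ {S S′} → Admissible S → Admissible S′ → trace S ≡ trace S′ → S ≡ S′
    trace-injective S-adm S′-adm same =
      ⊆-antisym (trace-⊆ S-adm S′-adm same) (trace-⊆ S′-adm S-adm (sym same))

module Arithmetic where

  open import Data.Nat.Tactic.RingSolver using (solve-∀)
  open ≤-Reasoning

  inside-arith : ∀ a aI aN t iT → a ≡ aI + aN → a + (aN + 0) ≤ t → aI ≤ iT → 2 * a ≤ t + iT
  inside-arith a aI aN t iT a≡aI+aN paired aI≤iT = begin
    2 * a                  ≡⟨ cong (λ n → a + (n + 0)) a≡aI+aN ⟩
    a + ((aI + aN) + 0)    ≡⟨ regroup a aI aN ⟩
    (a + (aN + 0)) + aI    ≤⟨ +-mono-≤ paired aI≤iT ⟩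
    t + iT                 ∎
    where
    regroup : ∀ a aI aN → a + ((aI + aN) + 0) ≡ (a + (aN + 0)) + aI
    regroup = solve-∀

  outside-arith-odd : ∀ b t u r iO → b + (b + (b + 0)) ≤ u → t + u ≡ r → 24 * b + 6 * t ≤ 8 * r + 6 * iO
  outside-arith-odd b t u r iO tripled t+u≡r = begin
    24 * b + 6 * t                 ≤⟨ +-monoʳ-≤ (24 * b) (*-monoˡ-≤ t (m≤m+n 6 2)) ⟩
    24 * b + 8 * t                 ≡⟨ regroup b t ⟩
    8 * ((b + (b + (b + 0))) + t)  ≤⟨ *-monoʳ-≤ 8 (+-monoˡ-≤ t tripled) ⟩
    8 * (u + t)                    ≡⟨ cong (8 *_) (trans (+-comm u t) t+u≡r) ⟩
    8 * r                          ≤⟨ m≤m+n (8 * r) (6 * iO) ⟩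
    8 * r + 6 * iO                 ∎
    where
    regroup : ∀ b t → 24 * b + 8 * t ≡ 8 * ((b + (b + (b + 0))) + t)
    regroup = solve-∀

  outside-arith-even : ∀ b bJ bN t u r iO jO q → b ≡ bJ + bN → b + (b + (bN + (bN + 0))) ≤ u →
                       t + u ≡ r → bJ + (bJ + 0) ≤ jO → jO ≤ iO + q → 6 * q ≤ r →
                       24 * b + 6 * t ≤ 8 * r + 6 * iO
  outside-arith-even b bJ bN t u r iO jO q b≡bJ+bN quadrupled t+u≡r doubled jO≤iO+q 6q≤r = begin
    24 * b + 6 * t
      ≡⟨ regroup b t ⟩
    6 * ((b + (b + (b + (b + 0)))) + t)
      ≡⟨ cong (λ n → 6 * ((b + (b + (n + (n + 0)))) + t)) b≡bJ+bN ⟩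
    6 * ((b + (b + ((bJ + bN) + ((bJ + bN) + 0)))) + t)
      ≡⟨ split b bJ bN t ⟩
    6 * ((b + (b + (bN + (bN + 0)))) + t) + 6 * (bJ + (bJ + 0))
      ≤⟨ +-mono-≤ (*-monoʳ-≤ 6 (+-monoˡ-≤ t quadrupled)) (*-monoʳ-≤ 6 (≤-trans doubled jO≤iO+q)) ⟩
    6 * (u + t) + 6 * (iO + q)
      ≡⟨ cong (λ n → 6 * n + 6 * (iO + q)) (trans (+-comm u t) t+u≡r) ⟩
    6 * r + 6 * (iO + q)
      ≡⟨ regroup′ r iO q ⟩
    6 * r + 6 * q + 6 * iO
      ≤⟨ +-monoˡ-≤ (6 * iO) (+-monoʳ-≤ (6 * r) (≤-trans 6q≤r (m≤n+m r r))) ⟩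
    6 * r + (r + r) + 6 * iO
      ≡⟨ cong (_+ 6 * iO) (regroup″ r) ⟩
    8 * r + 6 * iO
      ∎
    where
    regroup : ∀ b t → 24 * b + 6 * t ≡ 6 * ((b + (b + (b + (b + 0)))) + t)
    regroup = solve-∀
    split : ∀ b bJ bN t → 6 * ((b + (b + ((bJ + bN) + ((bJ + bN) + 0)))) + t)
                        ≡ 6 * ((b + (b + (bN + (bN + 0)))) + t) + 6 * (bJ + (bJ + 0))
    split = solve-∀
    regroup′ : ∀ r iO q → 6 * r + 6 * (iO + q) ≡ 6 * r + 6 * q + 6 * iO
    regroup′ = solve-∀
    regroup″ : ∀ r → 6 * r + (r + r) ≡ 8 * r
    regroup″ = solve-∀

  final-arith : ∀ c a b t iT iO r s → c ≤ a + b → 2 * a ≤ t + iT → 2 * t ≤ r →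
                24 * b + 6 * t ≤ 8 * r + 6 * iO → s ≡ iT + iO → 24 * c ≤ 11 * r + 12 * s
  final-arith c a b t iT iO r s c≤a+b inside t-half outside s≡iT+iO =
    +-cancelˡ-≤ (6 * t) (24 * c) (11 * r + 12 * s) (begin
      6 * t + 24 * c
        ≤⟨ +-monoʳ-≤ (6 * t) (*-monoʳ-≤ 24 c≤a+b) ⟩
      6 * t + 24 * (a + b)
        ≡⟨ regroup t a b ⟩
      12 * (2 * a) + (24 * b + 6 * t)
        ≤⟨ +-mono-≤ (*-monoʳ-≤ 12 inside) outside ⟩
      12 * (t + iT) + (8 * r + 6 * iO)
        ≡⟨ regroup′ t iT r iO ⟩
      6 * t + (3 * (2 * t) + 8 * r + 12 * iT + 6 * iO)
        ≤⟨ +-monoʳ-≤ (6 * t) (+-mono-≤ (+-monoˡ-≤ (12 * iT) (+-monoˡ-≤ (8 * r) (*-monoʳ-≤ 3 t-half)))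
                                       (*-monoˡ-≤ iO (m≤m+n 6 6))) ⟩
      6 * t + (3 * r + 8 * r + 12 * iT + 12 * iO)
        ≡⟨ cong (6 * t +_) (trans (regroup″ r iT iO) (cong (λ n → 11 * r + 12 * n) (sym s≡iT+iO))) ⟩
      6 * t + (11 * r + 12 * s)
        ∎)
    where
    regroup : ∀ t a b → 6 * t + 24 * (a + b) ≡ 12 * (2 * a) + (24 * b + 6 * t)
    regroup = solve-∀
    regroup′ : ∀ t iT r iO → 12 * (t + iT) + (8 * r + 6 * iO)
                           ≡ 6 * t + (3 * (2 * t) + 8 * r + 12 * iT + 6 * iO)
    regroup′ = solve-∀
    regroup″ : ∀ r iT iO → 3 * r + 8 * r + 12 * iT + 12 * iO ≡ 11 * r + 12 * (iT + iO)
    regroup″ = solve-∀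

module Representatives {r : ℕ} (G : FinAbGroup r) (g : Fin r) {M N : Subset r}
                       (M-sub : IsSubgroup G M) (N-sub : IsSubgroup G N) (M⊆N : M ⊆ N) where

  open import Data.Fin.Subset using (_∈_)
  open Group G
  open Counting r
  open Arithmetic

  -- IsSubgroup G M unfolds to IsSubgroupPred (_∈ M).
  private
    module M = SubgroupPred M-sub
    module N = SubgroupPred N-sub

  gN : Pred (Fin r) 0ℓ
  gN = InCoset G g N

  gN? : Decidable gN
  gN? x = map′ (λ g⁻¹x∈N → g ⁻¹ ∙ x , g⁻¹x∈N , sym (\\-leftDividesˡ g x))
               (λ { (n , n∈N , refl) → subst (_∈ N) (sym (\\-leftDividesʳ g n)) n∈N })
               ((g ⁻¹ ∙ x) ∈? N)

  ∉gN-∙ : ∀ {x n} → ¬ gN x → n ∈ N → ¬ gN (x ∙ n)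
  ∉gN-∙ {x} {n} x∉gN n∈N (k , k∈N , xn≡gk) =
    x∉gN (k ∙ n ⁻¹ , N.∙-closed k∈N (N.⁻¹-closed n∈N) , x≡g∙kn⁻¹)
    where
    x≡g∙kn⁻¹ : x ≡ g ∙ (k ∙ n ⁻¹)
    x≡g∙kn⁻¹ = trans (sym (//-rightDividesʳ n x)) (trans (cong (_∙ n ⁻¹) xn≡gk) (assoc g k (n ⁻¹)))

  Admissible : Subset r → Set
  Admissible S = InverseClosed G S × UnionOfCosets G (InDiff G S g N) M

  open AdmissibleSets Admissible public

  ∼-refl : ∀ {x} → x ∼ x
  ∼-refl {x} S _ = ⇔-id (x ∈ S)

  ∼-trans : ∀ {x y z} → x ∼ y → y ∼ z → x ∼ z
  ∼-trans x∼y y∼z S S-adm = y∼z S S-adm ⇔-∘ x∼y S S-adm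

  ∼-⁻¹ : ∀ {x} → x ∼ x ⁻¹
  ∼-⁻¹ {x} S (inverse-closed , _) =
    mk⇔ (inverse-closed x) (subst (_∈ S) (⁻¹-involutive x) ∘ inverse-closed (x ⁻¹))

  ∼-∙M : ∀ {x m} → ¬ gN x → m ∈ M → x ∼ x ∙ m
  ∼-∙M {x} {m} x∉gN m∈M S (_ , M-closed) = mk⇔
    (λ x∈S → proj₁ (M-closed x m (x∈S , x∉gN) m∈M))
    (λ xm∈S → subst (_∈ S) (//-rightDividesʳ m x)
                (proj₁ (M-closed (x ∙ m) (m ⁻¹) (xm∈S , ∉gN-∙ x∉gN (M⊆N m∈M)) (M.⁻¹-closed m∈M))))

  infix 4 _≈_ _≈±_

  _≈_ : Fin r → Fin r → Set
  x ≈ y = x ⁻¹ ∙ y ∈ M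

  ≈-refl : ∀ {x} → x ≈ x
  ≈-refl {x} = subst (_∈ M) (sym (inverseˡ x)) M.ε-closed

  ≈-sym : ∀ {x y} → x ≈ y → y ≈ x
  ≈-sym {x} {y} x≈y = subst (_∈ M) (⁻¹-anti-homo-\\ x y) (M.⁻¹-closed x≈y)

  ≈-trans : ∀ {x y z} → x ≈ y → y ≈ z → x ≈ z
  ≈-trans {x} {y} {z} x≈y y≈z = subst (_∈ M) x⁻¹y∙y⁻¹z≡x⁻¹z (M.∙-closed x≈y y≈z)
    where
    x⁻¹y∙y⁻¹z≡x⁻¹z : (x ⁻¹ ∙ y) ∙ (y ⁻¹ ∙ z) ≡ x ⁻¹ ∙ z
    x⁻¹y∙y⁻¹z≡x⁻¹z = trans (assoc (x ⁻¹) y (y ⁻¹ ∙ z)) (cong (x ⁻¹ ∙_) (\\-leftDividesˡ y z))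

  ≈-⁻¹ : ∀ {x y} → x ≈ y → x ⁻¹ ≈ y ⁻¹
  ≈-⁻¹ {x} {y} x≈y =
    subst (_∈ M) (trans (comm (y ⁻¹) x) (cong (_∙ y ⁻¹) (sym (⁻¹-involutive x)))) (≈-sym x≈y)

  ≈-∙ : ∀ {x m} → m ∈ M → x ≈ x ∙ m
  ≈-∙ {x} {m} m∈M = subst (_∈ M) (sym (\\-leftDividesʳ x m)) m∈M

  _≈±_ : Fin r → Fin r → Set
  x ≈± y = x ≈ y ⊎ x ≈ y ⁻¹

  _≈±?_ : ∀ x y → Dec (x ≈± y)
  x ≈±? y = ((x ⁻¹ ∙ y) ∈? M) ⊎-dec ((x ⁻¹ ∙ y ⁻¹) ∈? M)

  ≈±-refl : ∀ {x} → x ≈± x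
  ≈±-refl = inj₁ ≈-refl

  ≈±-sym : ∀ {x y} → x ≈± y → y ≈± x
  ≈±-sym (inj₁ x≈y) = inj₁ (≈-sym x≈y)
  ≈±-sym {x} {y} (inj₂ x≈y⁻¹) =
    inj₂ (≈-sym (subst (x ⁻¹ ≈_) (⁻¹-involutive y) (≈-⁻¹ x≈y⁻¹)))

  ≈±-trans : ∀ {x y z} → x ≈± y → y ≈± z → x ≈± z
  ≈±-trans         (inj₁ x≈y)   (inj₁ y≈z)   = inj₁ (≈-trans x≈y y≈z)
  ≈±-trans         (inj₁ x≈y)   (inj₂ y≈z⁻¹) = inj₂ (≈-trans x≈y y≈z⁻¹)
  ≈±-trans         (inj₂ x≈y⁻¹) (inj₁ y≈z)   = inj₂ (≈-trans x≈y⁻¹ (≈-⁻¹ y≈z))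
  ≈±-trans {y = y} {z} (inj₂ x≈y⁻¹) (inj₂ y≈z⁻¹) =
    inj₁ (≈-trans x≈y⁻¹ (subst (y ⁻¹ ≈_) (⁻¹-involutive z) (≈-⁻¹ y≈z⁻¹)))

  ≈⇒∼ : ∀ {x y} → ¬ gN x → x ≈ y → x ∼ y
  ≈⇒∼ {x} {y} x∉gN x≈y = subst (x ∼_) (\\-leftDividesˡ x y) (∼-∙M x∉gN x≈y)

  ≈±⇒∼ : ∀ {x y} → ¬ gN x → x ≈± y → x ∼ y
  ≈±⇒∼ x∉gN (inj₁ x≈y) = ≈⇒∼ x∉gN x≈y
  ≈±⇒∼ {y = y} x∉gN (inj₂ x≈y⁻¹) =
    ∼-trans (≈⇒∼ x∉gN x≈y⁻¹) (subst (y ⁻¹ ∼_) (⁻¹-involutive y) ∼-⁻¹)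

  SmallerOutside : Fin r → Pred (Fin r) 0ℓ
  SmallerOutside x y = ¬ gN y × x ≈± y × y F.< x

  smallerOutside? : ∀ x → Decidable (SmallerOutside x)
  smallerOutside? x y = ¬? (gN? y) ×-dec (x ≈±? y) ×-dec (y F.<? x)

  OutsideRep : Pred (Fin r) 0ℓ
  OutsideRep x = ¬ gN x × ¬ ∃ (SmallerOutside x)

  OutsideRep? : Decidable OutsideRep
  OutsideRep? x = ¬? (gN? x) ×-dec ¬? (any? (smallerOutside? x))

  outsideRep-minimal : ∀ {x y} → OutsideRep x → ¬ gN y → x ≈± y → x F.≤ y
  outsideRep-minimal (_ , none-smaller) y∉gN x≈±y =
    ≮⇒≥ (λ y<x → none-smaller (_ , y∉gN , x≈±y , y<x))

  outsideRep-unique : ∀ {x y} → OutsideRep x → OutsideRep y → x ≈± y → x ≡ y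
  outsideRep-unique Rx Ry x≈±y =
    F.≤-antisym (outsideRep-minimal Rx (proj₁ Ry) x≈±y)
                (outsideRep-minimal Ry (proj₁ Rx) (≈±-sym x≈±y))

  outsideRep-exists : ∀ {x} → ¬ gN x → ∃ λ y → OutsideRep y × x ≈± y
  outsideRep-exists {x} = descend (F.<-wellFounded x)
    where
    descend : ∀ {x} → Acc F._<_ x → ¬ gN x → ∃ λ y → OutsideRep y × x ≈± y
    descend {x} (acc smaller) x∉gN with any? (smallerOutside? x)
    ... | no  none-smaller = x , (x∉gN , none-smaller) , ≈±-refl
    ... | yes (y , y∉gN , x≈±y , y<x) =
      let z , Rz , y≈±z = descend (smaller y<x) y∉gN in z , Rz , ≈±-trans x≈±y y≈±z

  InsideRep : Pred (Fin r) 0ℓ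
  InsideRep x = gN x × gN (x ⁻¹) × x F.≤ x ⁻¹

  InsideRep? : Decidable InsideRep
  InsideRep? x = gN? x ×-dec gN? (x ⁻¹) ×-dec (x F.≤? x ⁻¹)

  Rep : Pred (Fin r) 0ℓ
  Rep = InsideRep ∪ OutsideRep

  Rep? : Decidable Rep
  Rep? = InsideRep? ∪? OutsideRep?

  represented : ∀ x → ∃ λ y → Rep y × x ∼ y
  represented x with gN? x | gN? (x ⁻¹)
  ... | no x∉gN | _ =
    let y , Ry , x≈±y = outsideRep-exists x∉gN
    in  y , inj₂ Ry , ≈±⇒∼ x∉gN x≈±y
  ... | yes _ | no x⁻¹∉gN =
    let y , Ry , x⁻¹≈±y = outsideRep-exists x⁻¹∉gN
    in  y , inj₂ Ry , ∼-trans ∼-⁻¹ (≈±⇒∼ x⁻¹∉gN x⁻¹≈±y)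
  ... | yes x∈gN | yes x⁻¹∈gN with x F.≤? x ⁻¹
  ...   | yes x≤x⁻¹ = x , inj₁ (x∈gN , x⁻¹∈gN , x≤x⁻¹) , ∼-refl
  ...   | no  x≰x⁻¹ = x ⁻¹ , inj₁ (x⁻¹∈gN , x⁻¹⁻¹∈gN , x⁻¹≤x⁻¹⁻¹) , ∼-⁻¹
    where
    x⁻¹⁻¹∈gN : gN (x ⁻¹ ⁻¹)
    x⁻¹⁻¹∈gN = subst gN (sym (⁻¹-involutive x)) x∈gN
    x⁻¹≤x⁻¹⁻¹ : x ⁻¹ F.≤ x ⁻¹ ⁻¹
    x⁻¹≤x⁻¹⁻¹ = subst (x ⁻¹ F.≤_) (sym (⁻¹-involutive x)) (<⇒≤ (≰⇒> x≰x⁻¹))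

  gN-half : Proper G N → 2 * count gN? ≤ r
  gN-half (y₀ , y₀∉N) = begin
    2 * count gN?               ≡⟨ cong (count gN? +_) (+-identityʳ _) ⟩
    count gN? + count gN?       ≤⟨ +-monoʳ-≤ (count gN?) gN≤∁gN ⟩
    count gN? + count (∁? gN?)  ≡⟨ count-∁ gN? ⟩
    r                           ∎
    where
    open ≤-Reasoning
    shifted-out : ∀ {x} → gN x → ¬ gN (x ∙ y₀)
    shifted-out (k , k∈N , refl) (k′ , k′∈N , gk∙y₀≡gk′) =
      y₀∉N (subst (_∈ N) (sym (y≈x\\z k y₀ k′ ky₀≡k′)) (N.⁻¹∙-closed k∈N k′∈N))
      where
      ky₀≡k′ : k ∙ y₀ ≡ k′
      ky₀≡k′ = ∙-cancelˡ g _ _ (trans (sym (assoc g k y₀)) gk∙y₀≡gk′)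
    gN≤∁gN = count-≤-injection gN? (∁? gN?) (_∙ y₀) (λ {x} {y} → ∙-cancelʳ y₀ x y) shifted-out

  gN± : Pred (Fin r) 0ℓ
  gN± x = gN x × gN (x ⁻¹)

  gN±? : Decidable gN±
  gN±? x = gN? x ×-dec gN? (x ⁻¹)

  insideRep-bound : count InsideRep? + (count (InsideRep? ∩? ∁? I?) + 0) ≤ count gN±?
  insideRep-bound =
    disjoint-images-count flip? flip?-injective D? gN±? {true ∷ false ∷ []}
      ((distinct ∷ []) ∷ [] ∷ []) (into-gN± ∷ into-gN±⁻¹ ∷ [])
    where
    flip? : Bool → Fin r → Fin r
    flip? true  x = x
    flip? false x = x ⁻¹
    flip?-injective : ∀ b → Injective _≡_ _≡_ (flip? b)
    flip?-injective true  = id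
    flip?-injective false = ⁻¹-injective
    D : Bool → Pred (Fin r) 0ℓ
    D true  = InsideRep
    D false = InsideRep ∩ ∁ I
    D? : ∀ b → Decidable (D b)
    D? true  = InsideRep?
    D? false = InsideRep? ∩? ∁? I?
    distinct : ∀ {x y} → InsideRep x → InsideRep y × ¬ I y → x ≢ y ⁻¹
    distinct {y = y} (_ , _ , y⁻¹≤y⁻¹⁻¹) ((_ , _ , y≤y⁻¹) , y∉I) refl =
      y∉I (trans (cong (y ∙_) y≡y⁻¹) (inverseʳ y))
      where
      y≡y⁻¹ : y ≡ y ⁻¹
      y≡y⁻¹ = F.≤-antisym y≤y⁻¹ (subst (y ⁻¹ F.≤_) (⁻¹-involutive y) y⁻¹≤y⁻¹⁻¹)
    into-gN± : ∀ {x} → InsideRep x → gN± x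
    into-gN± (x∈gN , x⁻¹∈gN , _) = x∈gN , x⁻¹∈gN
    into-gN±⁻¹ : ∀ {x} → InsideRep x × ¬ I x → gN± (x ⁻¹)
    into-gN±⁻¹ {x} ((x∈gN , x⁻¹∈gN , _) , _) = x⁻¹∈gN , subst gN (sym (⁻¹-involutive x)) x∈gN

  Move : Set
  Move = Bool × ∃ (_∈ M)

  move : Move → Fin r → Fin r
  move (true  , c , _) x = x ∙ c
  move (false , c , _) x = x ⁻¹ ∙ c

  move-injective : ∀ i → Injective _≡_ _≡_ (move i)
  move-injective (true  , c , _) {x} {y} = ∙-cancelʳ c x y
  move-injective (false , c , _) {x} {y} = ⁻¹-injective ∘ ∙-cancelʳ c (x ⁻¹) (y ⁻¹)

  ≈±-move : ∀ i {x} → x ≈± move i x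
  ≈±-move (true  , c , c∈M)     = inj₁ (≈-∙ c∈M)
  ≈±-move (false , c , c∈M) {x} =
    inj₂ (subst (_≈ (x ⁻¹ ∙ c) ⁻¹) (⁻¹-involutive x) (≈-⁻¹ (≈-∙ c∈M)))

  move-outside : ∀ i {x} → ¬ gN x → ¬ gN± (move i x)
  move-outside (true  , c , c∈M) x∉gN (xc∈gN , _) = ∉gN-∙ x∉gN (M⊆N c∈M) xc∈gN
  move-outside (false , c , c∈M) {x} x∉gN (_ , [x⁻¹c]⁻¹∈gN) =
    ∉gN-∙ x∉gN (M⊆N (M.⁻¹-closed c∈M)) (subst gN [x⁻¹c]⁻¹≡xc⁻¹ [x⁻¹c]⁻¹∈gN)
    where
    [x⁻¹c]⁻¹≡xc⁻¹ : (x ⁻¹ ∙ c) ⁻¹ ≡ x ∙ c ⁻¹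
    [x⁻¹c]⁻¹≡xc⁻¹ = trans (⁻¹-anti-homo-\\ x c) (comm (c ⁻¹) x)

  outside-moves-count : ∀ {D : Move → Pred (Fin r) 0ℓ} (D? : ∀ i → Decidable (D i))
                          {Q : Pred (Fin r) 0ℓ} (Q? : Decidable Q) → (∀ {i x} → D i x → OutsideRep x) →
                        ∀ {is} → AllPairs (λ i j → ∀ {x} → D i x → D j x → move i x ≢ move j x) is →
                        All (λ i → ∀ {x} → D i x → Q (move i x)) is →
                        sum (map (λ i → count (D? i)) is) ≤ count Q?
  outside-moves-count {D} D? Q? D⊆OutsideRep distinct into-Q =
    disjoint-images-count move move-injective D? Q? (AllPairs.map disjoint distinct) into-Q
    where
    disjoint : ∀ {i j} → (∀ {x} → D i x → D j x → move i x ≢ move j x) →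
               ∀ {x y} → D i x → D j y → move i x ≢ move j y
    disjoint {i} {j} distinct-at {x} {y} Dix Djy mix≡mjy
      with outsideRep-unique (D⊆OutsideRep Dix) (D⊆OutsideRep Djy)
             (≈±-trans (≈±-move i) (subst (_≈± y) (sym mix≡mjy) (≈±-sym (≈±-move j))))
    ... | refl = distinct-at Dix Djy mix≡mjy

  module _ {m₀} (m₀∈M : m₀ ∈ M) (m₀≢ε : m₀ ≢ ε) where

    private
      ε⁺ m₀⁺ : ∃ (_∈ M)
      ε⁺  = ε , M.ε-closed
      m₀⁺ = m₀ , m₀∈M

      same-sign-distinct : ∀ {s c c′} → proj₁ c ≢ proj₁ c′ →
                           ∀ {x} → move (s , c) x ≢ move (s , c′) x
      same-sign-distinct {true}  c≢c′ {x} = c≢c′ ∘ ∙-cancelˡ x _ _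
      same-sign-distinct {false} c≢c′ {x} = c≢c′ ∘ ∙-cancelˡ (x ⁻¹) _ _

      ε≢m₀ : ε ≢ m₀
      ε≢m₀ = m₀≢ε ∘ sym

    outsideRep-moves-odd : square m₀ ≢ ε → 3 * count OutsideRep? ≤ count (∁? gN±?)
    outsideRep-moves-odd m₀²≢ε =
      outside-moves-count (λ _ → OutsideRep?) (∁? gN±?) id
        {is = (true , ε⁺) ∷ (true , m₀⁺) ∷ (true , m₀²⁺) ∷ []}
        ( (distinct ε⁺ m₀⁺ ε≢m₀ ∷ distinct ε⁺ m₀²⁺ (m₀²≢ε ∘ sym) ∷ [])
        ∷ (distinct m₀⁺ m₀²⁺ m₀≢m₀² ∷ [])
        ∷ [] ∷ [])
        (outside (true , ε⁺) ∷ outside (true , m₀⁺) ∷ outside (true , m₀²⁺) ∷ [])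
      where
      m₀²⁺ : ∃ (_∈ M)
      m₀²⁺ = square m₀ , M.∙-closed m₀∈M m₀∈M
      m₀≢m₀² : m₀ ≢ square m₀
      m₀≢m₀² m₀≡m₀² = m₀≢ε (sym (∙-cancelˡ m₀ ε m₀ (trans (identityʳ m₀) m₀≡m₀²)))
      distinct : ∀ (c c′ : ∃ (_∈ M)) → proj₁ c ≢ proj₁ c′ → ∀ {x} → OutsideRep x → OutsideRep x →
                 move (true , c) x ≢ move (true , c′) x
      distinct c c′ c≢c′ _ _ = same-sign-distinct {true} {c} {c′} c≢c′
      outside : ∀ i {x} → OutsideRep x → ¬ gN± (move i x)
      outside i = move-outside i ∘ proj₁

    module _ (m₀²≡ε : square m₀ ≡ ε) where

      open SquareRoots m₀≢ε m₀²≡ε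

      private
        D : Move → Pred (Fin r) 0ℓ
        D (true  , _) = OutsideRep
        D (false , _) = OutsideRep ∩ ∁ J

        D? : ∀ i → Decidable (D i)
        D? (true  , _) = OutsideRep?
        D? (false , _) = OutsideRep? ∩? ∁? J?

        D⊆OutsideRep : ∀ {i x} → D i x → OutsideRep x
        D⊆OutsideRep {true  , _} = id
        D⊆OutsideRep {false , _} = proj₁

        mixed-distinct : ∀ (a b : ∃ (_∈ M)) → let q = proj₁ b ∙ proj₁ a ⁻¹ in q ≡ ε ⊎ q ≡ m₀ →
                         ∀ {x} → D (true , a) x → D (false , b) x → x ∙ proj₁ a ≢ x ⁻¹ ∙ proj₁ b
        mixed-distinct a b q≡ε∨m₀ _ (_ , x∉J) xa≡x⁻¹b =
          x∉J (Sum.map (trans x²≡q) (trans x²≡q) q≡ε∨m₀)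
          where x²≡q = ∙-≡-⁻¹∙⇒square xa≡x⁻¹b

      outsideRep-moves-even : count OutsideRep? + (count OutsideRep? + (count (OutsideRep? ∩? ∁? J?)
                           + (count (OutsideRep? ∩? ∁? J?) + 0))) ≤ count (∁? gN±?)
      outsideRep-moves-even =
        outside-moves-count D? (∁? gN±?) (λ {i} → D⊆OutsideRep {i})
          {is = (true , ε⁺) ∷ (true , m₀⁺) ∷ (false , ε⁺) ∷ (false , m₀⁺) ∷ []}
          ( ((λ _ _ → same-sign-distinct {true} {ε⁺} {m₀⁺} ε≢m₀)
            ∷ mixed-distinct ε⁺ ε⁺ (inj₁ (inverseʳ ε))
            ∷ mixed-distinct ε⁺ m₀⁺ (inj₂ (trans (cong (m₀ ∙_) ε⁻¹≈ε) (identityʳ m₀)))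
            ∷ [])
          ∷ ( mixed-distinct m₀⁺ ε⁺ (inj₂ (trans (identityˡ (m₀ ⁻¹)) m⁻¹≡m))
            ∷ mixed-distinct m₀⁺ m₀⁺ (inj₁ (inverseʳ m₀))
            ∷ [])
          ∷ ((λ _ _ → same-sign-distinct {false} {ε⁺} {m₀⁺} ε≢m₀) ∷ [])
          ∷ [] ∷ [])
          ( outside (true , ε⁺) ∷ outside (true , m₀⁺)
          ∷ outside (false , ε⁺) ∷ outside (false , m₀⁺) ∷ [])
        where
        outside : ∀ i {x} → D i x → ¬ gN± (move i x)
        outside i = move-outside i ∘ proj₁ ∘ D⊆OutsideRep {i}

      outsideRep∩J-moves : 2 * count (OutsideRep? ∩? J?) ≤ count (J? ∩? ∁? gN?)
      outsideRep∩J-moves =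
        outside-moves-count (λ _ → OutsideRep? ∩? J?) (J? ∩? ∁? gN?) proj₁
          {is = (true , ε⁺) ∷ (true , m₀⁺) ∷ []}
          (((λ _ _ → same-sign-distinct {true} {ε⁺} {m₀⁺} ε≢m₀) ∷ []) ∷ [] ∷ [])
          (into ε⁺ (identityˡ ε) ∷ into m₀⁺ m₀²≡ε ∷ [])
        where
        into : ∀ (c : ∃ (_∈ M)) → square (proj₁ c) ≡ ε →
               ∀ {x} → OutsideRep x × J x → J (x ∙ proj₁ c) × ¬ gN (x ∙ proj₁ c)
        into (c , c∈M) c²≡ε {x} ((x∉gN , _) , Jx) =
          Sum.map (trans xc²≡x²) (trans xc²≡x²) Jx , ∉gN-∙ x∉gN (M⊆N c∈M)
          where
          xc²≡x² : square (x ∙ c) ≡ square x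
          xc²≡x² = trans (square-∙-≡ refl c²≡ε) (identityʳ (square x))

      J∖gN-bound : count (J? ∩? ∁? gN?) ≤ count (I? ∩? ∁? gN?) + count Root?
      J∖gN-bound = begin
        count (J? ∩? ∁? gN?)
          ≡⟨ count-split (J? ∩? ∁? gN?) I? ⟩
        count ((J? ∩? ∁? gN?) ∩? I?) + count ((J? ∩? ∁? gN?) ∩? ∁? I?)
          ≤⟨ +-mono-≤ (count-mono _ (I? ∩? ∁? gN?) in-I∖gN) (count-mono _ Root? in-Root) ⟩
        count (I? ∩? ∁? gN?) + count Root?
          ∎
        where
        open ≤-Reasoning
        in-I∖gN : ∀ {x} → (J x × ¬ gN x) × I x → I x × ¬ gN x
        in-I∖gN ((_ , x∉gN) , Ix) = Ix , x∉gN
        in-Root : ∀ {x} → (J x × ¬ gN x) × ¬ I x → Root x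
        in-Root ((Jx , _) , x∉I) = [ ⊥-elim ∘ x∉I , id ] Jx

  outsideRep-bound : Nontrivial G M → ¬ Is2Group G →
                     24 * count OutsideRep? + 6 * count gN±? ≤ 8 * r + 6 * count (I? ∩? ∁? gN?)
  outsideRep-bound (m₀ , m₀∈M , m₀≢ε) not-2-group with square m₀ ≟ ε
  ... | no  m₀²≢ε =
    outside-arith-odd b t u r iO (outsideRep-moves-odd m₀∈M m₀≢ε m₀²≢ε) (count-∁ gN±?)
    where
    b = count OutsideRep?
    t = count gN±?
    u = count (∁? gN±?)
    iO = count (I? ∩? ∁? gN?)
  ... | yes m₀²≡ε =
    outside-arith-even b bJ bN t u r iO jO q (count-split OutsideRep? J?)
      (outsideRep-moves-even m₀∈M m₀≢ε m₀²≡ε) (count-∁ gN±?) (outsideRep∩J-moves m₀∈M m₀≢ε m₀²≡ε)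
      (J∖gN-bound m₀∈M m₀≢ε m₀²≡ε) (square-roots-bound not-2-group)
    where
    open SquareRoots m₀≢ε m₀²≡ε
    b = count OutsideRep?
    bJ = count (OutsideRep? ∩? J?)
    bN = count (OutsideRep? ∩? ∁? J?)
    t = count gN±?
    u = count (∁? gN±?)
    iO = count (I? ∩? ∁? gN?)
    jO = count (J? ∩? ∁? gN?)
    q = count Root?

  gN±-half : Proper G N → 2 * count gN±? ≤ r
  gN±-half N-proper = ≤-trans (*-monoʳ-≤ 2 (count-mono gN±? gN? proj₁)) (gN-half N-proper)

  count-Rep-≤ : count Rep? ≤ count InsideRep? + count OutsideRep?
  count-Rep-≤ = begin
    count Rep?
      ≡⟨ count-split Rep? InsideRep? ⟩
    count (Rep? ∩? InsideRep?) + count (Rep? ∩? ∁? InsideRep?)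
      ≤⟨ +-mono-≤ (count-mono _ InsideRep? proj₂) (count-mono _ OutsideRep? in-Outside) ⟩
    count InsideRep? + count OutsideRep?
      ∎
    where
    open ≤-Reasoning
    in-Outside : ∀ {x} → Rep x × ¬ InsideRep x → OutsideRep x
    in-Outside (Rx , x∉InsideRep) = [ ⊥-elim ∘ x∉InsideRep , id ] Rx

  count-Rep-bound : Nontrivial G M → Proper G N → ¬ Is2Group G → 24 * count Rep? ≤ 11 * r + 12 * sizeI G
  count-Rep-bound M-nontrivial N-proper not-2-group =
    final-arith (count Rep?) a b t iT iO r (sizeI G) count-Rep-≤
      (inside-arith a aI aN t iT (count-split InsideRep? I?) insideRep-bound
        (count-mono (InsideRep? ∩? I?) (I? ∩? gN?) (λ ((x∈gN , _) , Ix) → Ix , x∈gN)))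
      (gN±-half N-proper) (outsideRep-bound M-nontrivial not-2-group) (count-split I? gN?)
    where
    a  = count InsideRep?
    aI = count (InsideRep? ∩? I?)
    aN = count (InsideRep? ∩? ∁? I?)
    b  = count OutsideRep?
    t  = count gN±?
    iT = count (I? ∩? gN?)
    iO = count (I? ∩? ∁? gN?)

lemma4p4 : (r : ℕ) (G : FinAbGroup r)
  → (∀ e → IsExponent G e → 2 < e)
  → ¬ Is2Group G
  → (g : Fin r) (M N : Subset r)
  → IsSubgroup G M → IsSubgroup G N
  → Nontrivial G M → M ⊆ N → Proper G N
  → (Ss : List (Subset r)) → Unique Ss
  → All (λ S → InverseClosed G S × UnionOfCosets G (InDiff G S g N) M) Ss
  → length Ss ^ 24 ≤ 2 ^ (11 * r + 12 * sizeI G)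
lemma4p4 r G _ not-2-group g M N M-sub N-sub M-nontrivial M⊆N N-proper Ss Ss! admissible = begin
  length Ss ^ 24               ≤⟨ ^-monoˡ-≤ 24 (admissible-count Rep? represented Ss! admissible) ⟩
  (2 ^ count Rep?) ^ 24        ≡⟨ ^-*-assoc 2 (count Rep?) 24 ⟩
  2 ^ (count Rep? * 24)        ≤⟨ ^-monoʳ-≤ 2 (subst (_≤ 11 * r + 12 * sizeI G) (*-comm 24 (count Rep?))
                                                   (count-Rep-bound M-nontrivial N-proper not-2-group)) ⟩
  2 ^ (11 * r + 12 * sizeI G)  ∎
  where
  open Representatives G g M-sub N-sub M⊆N
  open Counting r
  open ≤-Reasoning
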